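{- Let $P$ be a normal logic program and let $r = q\leftarrow a_1,\ldots,a_k,\mathbf{not}(b_1),\ldots,\mathbf{not}(b_l)$ be a clause of $P$. (1) Let $M$ be a stable model of $P$. If $\{a_1,\ldots,a_k\}\subseteq M$ and $\{b_1,\ldots,b_l\}\cap M=\emptyset$, then $M\setminus\{q,a_1,\ldots,a_k\}$ is a stable model of $P(r^+)$; otherwise $M$ is a stable model of $P(r^-)$. (2) $s(P)\le s(P(r^+))+s(P(r^-))$.
   Context: A (normal) logic program is a finite set of clauses $a\leftarrow b_1,\ldots,b_m,\mathbf{not}(c_1),\ldots,\mathbf{not}(c_k)$ with atoms $a,b_i,c_j$. For a set of atoms $M$, the reduct $P^M$ is obtained by deleting every clause whose body contains $\mathbf{not}(c)$ with $c\in M$ and deleting all negative literals from the remaining clauses; $M$ is a stable model of $P$ if $M$ is the least model of $P^M$; $s(P)$ is the number of stable models. For disjoint sets of atoms $T,F$, $simp(P,T,F)$ is obtained from $P$ by: removing all clauses with head in $T\cup F$; removing all clauses containing an atom of $F$ positively in the body; removing all clauses containing $\mathbf{not}(a)$ with $a\in T$ in the body; and removing from the bodies of the remaining clauses all atoms $a\in T$ and all literals $\mathbf{not}(a)$ with $a\in F$. For the clause $r$ above, $P(r^+)=simp(P,\{q,a_1,\ldots,a_k\},\{b_1,\ldots,b_l\})$ and $P(r^-)=P\setminus\{r\}$. -}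

module Defs where

open import Data.Nat using (ℕ; zero; suc)
open import Data.Bool using (true; false)
open import Data.Fin using (Fin) renaming (_≟_ to _≟ᶠ_)
open import Data.Fin.Subset using (Subset; _∈_; _∉_; _⊆_; _∪_; ⁅_⁆; ⊥)
open import Data.Fin.Subset.Properties using (_∈?_; _⊆?_; anySubset?)
open import Data.Vec using (_∷_; [])
open import Data.List using (List; []; _∷_; map; filter; length; _++_; foldr)
open import Data.List.Properties using (≡-dec)
open import Data.List.Relation.Unary.All using (All; all?)
open import Data.List.Relation.Unary.Any using (Any; any?)
open import Data.Product using (_×_; _,_; ∃; proj₁; proj₂)
open import Relation.Nullary using (Dec; yes; no; ¬_; ¬?)
open import Relation.Nullary.Decidable using (_×-dec_; _→-dec_; map′)
open import Relation.Binary.PropositionalEquality using (_≡_; refl; cong₂)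
open import Relation.Binary.Definitions using (DecidableEquality)

record Clause (n : ℕ) : Set where
  constructor _←_,not_
  field
    head : Fin n
    pos  : List (Fin n)
    neg  : List (Fin n)
open Clause public

Program : ℕ → Set
Program n = List (Clause n)

record DClause (n : ℕ) : Set where
  constructor _⇐_
  field
    dhead : Fin n
    dbody : List (Fin n)
open DClause public

DProgram : ℕ → Set
DProgram n = List (DClause n)

fromList : ∀ {n} → List (Fin n) → Subset n
fromList = foldr (λ a S → ⁅ a ⁆ ∪ S) ⊥

IsModel : ∀ {n} → DProgram n → Subset n → Set
IsModel Q M = All (λ c → All (_∈ M) (dbody c) → dhead c ∈ M) Q

IsLeastModel : ∀ {n} → DProgram n → Subset n → Set
IsLeastModel Q M = IsModel Q M × (∀ N → IsModel Q N → M ⊆ N)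

reduct : ∀ {n} → Program n → Subset n → DProgram n
reduct P M = map (λ c → head c ⇐ pos c)
                 (filter (λ c → all? (λ b → ¬? (b ∈? M)) (neg c)) P)

Stable : ∀ {n} → Program n → Subset n → Set
Stable P M = IsLeastModel (reduct P M) M

simpKeep : ∀ {n} → Subset n → Subset n → Clause n → Set
simpKeep T F c = (head c ∉ T) × (head c ∉ F)
               × All (_∉ F) (pos c) × All (_∉ T) (neg c)

simpKeep? : ∀ {n} (T F : Subset n) (c : Clause n) → Dec (simpKeep T F c)
simpKeep? T F c = ¬? (head c ∈? T) ×-dec ¬? (head c ∈? F)
                ×-dec all? (λ a → ¬? (a ∈? F)) (pos c)
                ×-dec all? (λ a → ¬? (a ∈? T)) (neg c)

simp : ∀ {n} → Program n → Subset n → Subset n → Program n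
simp P T F =
  map (λ c → head c ← filter (λ a → ¬? (a ∈? T)) (pos c)
                  ,not filter (λ a → ¬? (a ∈? F)) (neg c))
      (filter (simpKeep? T F) P)

clause-≟ : ∀ {n} → DecidableEquality (Clause n)
clause-≟ (h ← p ,not m) (h' ← p' ,not m') with h ≟ᶠ h' | ≡-dec _≟ᶠ_ p p' | ≡-dec _≟ᶠ_ m m'
... | yes refl | yes refl | yes refl = yes refl
... | no ne | _ | _ = no λ { refl → ne refl }
... | yes _ | no ne | _ = no λ { refl → ne refl }
... | yes _ | yes _ | no ne = no λ { refl → ne refl }

Pplus : ∀ {n} → Program n → Clause n → Program n
Pplus P r = simp P (fromList (head r ∷ pos r)) (fromList (neg r))

Pminus : ∀ {n} → Program n → Clause n → Program n
Pminus P r = filter (λ c → ¬? (clause-≟ c r)) P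

-- all subsets of Fin n, each exactly once
allSubsets : ∀ n → List (Subset n)
allSubsets zero = [] ∷ []
allSubsets (suc n) = map (true ∷_) (allSubsets n) ++ map (false ∷_) (allSubsets n)

isModel? : ∀ {n} (Q : DProgram n) (M : Subset n) → Dec (IsModel Q M)
isModel? Q M = all? (λ c → all? (_∈? M) (dbody c) →-dec (dhead c ∈? M)) Q

isLeastModel? : ∀ {n} (Q : DProgram n) (M : Subset n) → Dec (IsLeastModel Q M)
isLeastModel? Q M = isModel? Q M ×-dec least?
  where
  least? : Dec (∀ N → IsModel Q N → M ⊆ N)
  least? with anySubset? (λ N → isModel? Q N ×-dec ¬? (M ⊆? N))
  ... | yes (N , m , nsub) = no λ h → nsub (h N m)
  ... | no none = yes λ N m → Relation.Nullary.Decidable.decidable-stable (M ⊆? N)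
                                 (λ nsub → none (N , m , nsub))

stable? : ∀ {n} (P : Program n) (M : Subset n) → Dec (Stable P M)
stable? P M = isLeastModel? (reduct P M) M

s : ∀ {n} → Program n → ℕ
s {n} P = length (filter (stable? P) (allSubsets n))

{-# OPTIONS --safe #-}
-- If the body of r holds in a stable model M of P, then q, a₁,…,aₖ ∈ M and b₁,…,bₗ ∉ M,
-- so simplifying P by these truth values is sound: M ∖ {q, a₁,…,aₖ} is still the least
-- model of the reduct, since any model N of the simplified reduct yields the model
-- (N ∪ {q, a₁,…,aₖ}) ∩ M of P^M. Otherwise r never fires in M and may be deleted.
-- Counting: every stable model of P lands in P(r⁺) or P(r⁻), and on the first side
-- M ↦ M ∖ {q, a₁,…,aₖ} is injective because all these M contain {q, a₁,…,aₖ}.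
module Submission where

open import Defs
open import Data.Nat using (_≤_; _+_)
open import Data.Fin.Subset using (_∈_; _∉_; _─_)
open import Data.List.Relation.Unary.All using (All)
open import Data.List.Membership.Propositional using () renaming (_∈_ to _∈ₗ_)
open import Data.List using (_∷_)
open import Data.Product using (_×_)
open import Relation.Nullary using (¬_)

open import Level using (Level)
open import Function using (_∘_; case_of_)
open import Data.Nat using (ℕ; suc)
open import Data.Nat.Properties using (+-suc; +-identityʳ; +-mono-≤; +-monoˡ-≤; m≤n+m; module ≤-Reasoning)
open import Data.Bool using (true; false)
open import Data.Fin using (Fin)
open import Data.Fin.Subset using (Subset; _⊆_; _∪_; _∩_; ⁅_⁆)
open import Data.Fin.Subset.Properties
  using (_∈?_; _⊆?_; x∈p∪q⁻; x∈p∪q⁺; x∈p∩q⁻; x∈p∩q⁺; x∈⁅y⁆⇒x≡y; ∉⊥; p─q⊆p; x∈p∧x∉q⇒x∈p─q; drop-∷-⊆)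
open import Data.Vec using ([]; _∷_)
open import Data.Vec.Base using (here; there)
open import Data.List using (List; []; map; filter; length; _++_)
open import Data.List.Properties using (filter-++; filter-none; length-++)
import Data.List.Relation.Unary.All as All
import Data.List.Relation.Unary.All.Properties as All
open import Data.List.Relation.Unary.Any using () renaming (here to hereₗ; there to thereₗ)
open import Data.List.Membership.Propositional.Properties using (∈-map⁺; ∈-map⁻; ∈-filter⁺; ∈-filter⁻)
open import Data.List.Relation.Binary.Sublist.Propositional using (⊆-refl)
import Data.List.Relation.Binary.Sublist.Propositional.Properties as Sublist
open import Data.Product using (∃; _,_; proj₁; proj₂; map₁)
open import Data.Sum using (inj₁; inj₂)
open import Data.Empty using (⊥-elim)
open import Relation.Nullary using (Dec; does; yes; no; ¬?; contradiction)
open import Relation.Nullary.Decidable using (_×-dec_; decidable-stable)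
open import Relation.Unary using (Pred; Decidable)
open import Relation.Unary.Properties using (_∩?_; ∁?)
open import Relation.Binary.PropositionalEquality using (_≡_; refl; sym; trans; cong; cong₂; module ≡-Reasoning)

private
  variable
    a p q : Level
    A B : Set a
    n : ℕ

x∈p─q⇒x∉q : ∀ {x : Fin n} {p q : Subset n} → x ∈ p ─ q → x ∉ q
x∈p─q⇒x∉q {p = true ∷ _} {q = false ∷ _} here        ()
x∈p─q⇒x∉q {p = _    ∷ _} {q = _     ∷ _} (there x∈) (there x∈q) = x∈p─q⇒x∉q x∈ x∈q

x∈p∪q∧x∉q⇒x∈p : ∀ {x : Fin n} {p q : Subset n} → x ∈ p ∪ q → x ∉ q → x ∈ p
x∈p∪q∧x∉q⇒x∈p {p = p} {q} x∈p∪q x∉q with x∈p∪q⁻ p q x∈p∪q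
... | inj₁ x∈p = x∈p
... | inj₂ x∈q = contradiction x∈q x∉q

∈-fromList⁻ : ∀ {x : Fin n} xs → x ∈ fromList xs → x ∈ₗ xs
∈-fromList⁻ []       x∈ = ⊥-elim (∉⊥ x∈)
∈-fromList⁻ (y ∷ xs) x∈ with x∈p∪q⁻ ⁅ y ⁆ (fromList xs) x∈
... | inj₁ x∈⁅y⁆ = hereₗ (x∈⁅y⁆⇒x≡y y x∈⁅y⁆)
... | inj₂ x∈xs  = thereₗ (∈-fromList⁻ xs x∈xs)

lookup-fromList : ∀ {P : Pred (Fin n) p} {xs} → All P xs → ∀ {x} → x ∈ fromList xs → P x
lookup-fromList {xs = xs} Pxs x∈ = All.lookup Pxs (∈-fromList⁻ xs x∈)

all-filter∉⁻ : ∀ {Q : Pred (Fin n) p} (Y : Subset n) {xs} → (∀ {a} → a ∈ Y → Q a) →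
  All Q (filter (λ a → ¬? (a ∈? Y)) xs) → All Q xs
all-filter∉⁻ Y {xs} Y⊆Q Qfiltered =
  All.filter⁻ (λ a → ¬? (a ∈? Y)) Qfiltered
    (All.map (Y⊆Q ∘ decidable-stable (_ ∈? Y)) (All.all-filter (∁? (λ a → ¬? (a ∈? Y))) xs))

all-∪-filter∉ : ∀ {N Y : Subset n} {xs} → All (_∈ N ∪ Y) xs → All (_∈ N) (filter (λ a → ¬? (a ∈? Y)) xs)
all-∪-filter∉ {xs = xs} all∈N∪Y =
  All.zipWith (λ (a∈N∪Y , a∉Y) → x∈p∪q∧x∉q⇒x∈p a∈N∪Y a∉Y)
              (All.filter⁺ _ all∈N∪Y , All.all-filter _ xs)

Applicable : Subset n → Clause n → Set
Applicable M c = All (_∈ M) (pos c) × All (_∉ M) (neg c)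

negHolds? : (M : Subset n) (c : Clause n) → Dec (All (_∉ M) (neg c))
negHolds? M c = All.all? (λ b → ¬? (b ∈? M)) (neg c)

applicable? : (M : Subset n) (c : Clause n) → Dec (Applicable M c)
applicable? M c = All.all? (_∈? M) (pos c) ×-dec negHolds? M c

ReductModel : Program n → Subset n → Subset n → Set
ReductModel P M N = ∀ {c} → c ∈ₗ P → All (_∉ M) (neg c) → All (_∈ N) (pos c) → head c ∈ N

isModel-reduct⁻ : ∀ {P : Program n} {M N} → IsModel (reduct P M) N → ReductModel P M N
isModel-reduct⁻ {M = M} N⊨ c∈P negM posN =
  All.lookup N⊨ (∈-map⁺ _ (∈-filter⁺ (negHolds? M) c∈P negM)) posN

isModel-reduct⁺ : ∀ {P : Program n} {M N} → ReductModel P M N → IsModel (reduct P M) N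
isModel-reduct⁺ {P = P} {M} {N} N⊨ = All.tabulate λ d∈ → clauseOf (∈-map⁻ _ d∈)
  where
  clauseOf : ∀ {d} → ∃ (λ c → c ∈ₗ filter (negHolds? M) P × d ≡ (head c ⇐ pos c)) →
             All (_∈ N) (dbody d) → dhead d ∈ N
  clauseOf (c , c∈ , refl) = let c∈P , negM = ∈-filter⁻ (negHolds? M) c∈ in N⊨ c∈P negM

applicable⇒head∈ : ∀ {P : Program n} {M c} → Stable P M → c ∈ₗ P → Applicable M c → head c ∈ M
applicable⇒head∈ (M⊨ , _) c∈P (posM , negM) = isModel-reduct⁻ M⊨ c∈P negM posM

-- N ∩ M is a model of P^M as soon as N is closed under the clauses that fire in M.
stable-least : ∀ {P : Program n} {M N} → Stable P M →
  (∀ {c} → c ∈ₗ P → Applicable M c → All (_∈ N) (pos c) → head c ∈ N) → M ⊆ N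
stable-least {P = P} {M} {N} M∈SM@(_ , least) N-closed x∈M =
  proj₁ (x∈p∩q⁻ N M (least (N ∩ M) (isModel-reduct⁺ N∩M⊨) x∈M))
  where
  N∩M⊨ : ReductModel P M (N ∩ M)
  N∩M⊨ c∈P negM posN∩M =
    let posN = All.map (proj₁ ∘ x∈p∩q⁻ N M) posN∩M
        posM = All.map (proj₂ ∘ x∈p∩q⁻ N M) posN∩M
    in x∈p∩q⁺ (N-closed c∈P (posM , negM) posN , applicable⇒head∈ M∈SM c∈P (posM , negM))

stable-drop-inapplicable : ∀ {P Q : Program n} {M} → (∀ {c} → c ∈ₗ Q → c ∈ₗ P) →
  (∀ {c} → c ∈ₗ P → Applicable M c → c ∈ₗ Q) → Stable P M → Stable Q M
stable-drop-inapplicable Q⊆P applicable∈Q M∈SM@(M⊨ , _) =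
  isModel-reduct⁺ (isModel-reduct⁻ M⊨ ∘ Q⊆P) ,
  λ N N⊨ → stable-least M∈SM λ c∈P app → isModel-reduct⁻ N⊨ (applicable∈Q c∈P app) (proj₂ app)

simpClause : Subset n → Subset n → Clause n → Clause n
simpClause T F c = head c ← filter (λ a → ¬? (a ∈? T)) (pos c) ,not filter (λ b → ¬? (b ∈? F)) (neg c)

∈-simp⁻ : ∀ {P : Program n} {T F d} → d ∈ₗ simp P T F →
  ∃ λ c → c ∈ₗ P × simpKeep T F c × d ≡ simpClause T F c
∈-simp⁻ {T = T} {F} d∈ with ∈-map⁻ (simpClause T F) d∈
... | c , c∈ , refl = let c∈P , keep = ∈-filter⁻ (simpKeep? T F) c∈ in c , c∈P , keep , refl

∈-simp⁺ : ∀ {P : Program n} {T F c} → c ∈ₗ P → simpKeep T F c → simpClause T F c ∈ₗ simp P T F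
∈-simp⁺ {T = T} {F} c∈P keep = ∈-map⁺ (simpClause T F) (∈-filter⁺ (simpKeep? T F) c∈P keep)

module _ {P : Program n} {M T F : Subset n}
         (M∈SM : Stable P M) (T⊆M : T ⊆ M) (F∉M : ∀ {x} → x ∈ F → x ∉ M) where

  simpKeep⇒applicable : ∀ {c} → simpKeep T F c → All (_∈ M ─ T) (pos (simpClause T F c)) →
    All (_∉ M ─ T) (neg (simpClause T F c)) → Applicable M c
  simpKeep⇒applicable (_ , _ , _ , negc∉T) posM─T negM─T =
    all-filter∉⁻ T T⊆M (All.map (p─q⊆p M T) posM─T) ,
    all-filter∉⁻ F F∉M (All.zipWith (λ (b∉M─T , b∉T) b∈M → b∉M─T (x∈p∧x∉q⇒x∈p─q b∈M b∉T))
                                    (negM─T , All.filter⁺ _ negc∉T))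

  applicable⇒simpKeep : ∀ {c} → c ∈ₗ P → Applicable M c → head c ∉ T → simpKeep T F c
  applicable⇒simpKeep c∈P app@(posM , negM) head∉T =
    head∉T , (λ head∈F → F∉M head∈F (applicable⇒head∈ M∈SM c∈P app)) ,
    All.map (λ a∈M a∈F → F∉M a∈F a∈M) posM , All.map (λ b∉M b∈T → b∉M (T⊆M b∈T)) negM

  stable-simp : Stable (simp P T F) (M ─ T)
  stable-simp = isModel-reduct⁺ M─T⊨ , M─T-least
    where
    M─T⊨ : ReductModel (simp P T F) (M ─ T) (M ─ T)
    M─T⊨ d∈ negM─T posM─T with ∈-simp⁻ {P = P} d∈
    ... | c , c∈P , keep , refl =
      x∈p∧x∉q⇒x∈p─q (applicable⇒head∈ M∈SM c∈P (simpKeep⇒applicable keep posM─T negM─T)) (proj₁ keep)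

    M─T-least : ∀ N → IsModel (reduct (simp P T F) (M ─ T)) N → M ─ T ⊆ N
    M─T-least N N⊨ x∈M─T = x∈p∪q∧x∉q⇒x∈p (M⊆N∪T (p─q⊆p M T x∈M─T)) (x∈p─q⇒x∉q x∈M─T)
      where
      M⊆N∪T : M ⊆ N ∪ T
      M⊆N∪T = stable-least {P = P} M∈SM λ {c} c∈P app posN∪T → case head c ∈? T of λ where
        (yes head∈T) → x∈p∪q⁺ (inj₂ head∈T)
        (no head∉T)  → x∈p∪q⁺ (inj₁ (isModel-reduct⁻ N⊨ (∈-simp⁺ c∈P (applicable⇒simpKeep c∈P app head∉T))
                                       (All.filter⁺ _ (All.map (_∘ p─q⊆p M T) (proj₂ app)))
                                       (all-∪-filter∉ posN∪T)))

module _ {P : Program n} {r : Clause n} (r∈P : r ∈ₗ P) {M : Subset n} (M∈SM : Stable P M) where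

  applicable⇒head∷pos⊆ : Applicable M r → fromList (head r ∷ pos r) ⊆ M
  applicable⇒head∷pos⊆ app@(posM , _) = lookup-fromList (applicable⇒head∈ M∈SM r∈P app All.∷ posM)

  stable-Pplus : Applicable M r → Stable (Pplus P r) (M ─ fromList (head r ∷ pos r))
  stable-Pplus app@(_ , negM) = stable-simp {P = P} M∈SM (applicable⇒head∷pos⊆ app) (lookup-fromList negM)

  stable-Pminus : ¬ Applicable M r → Stable (Pminus P r) M
  stable-Pminus ¬app = stable-drop-inapplicable (proj₁ ∘ ∈-filter⁻ (λ c → ¬? (clause-≟ c r))) applicable∈Pminus M∈SM
    where
    applicable∈Pminus : ∀ {c} → c ∈ₗ P → Applicable M c → c ∈ₗ Pminus P r
    applicable∈Pminus {c} c∈P app with clause-≟ c r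
    ... | yes refl = contradiction app ¬app
    ... | no c≢r   = ∈-filter⁺ (λ c → ¬? (clause-≟ c r)) c∈P c≢r

count : ∀ {P : Pred A p} → Decidable P → List A → ℕ
count P? = length ∘ filter P?

count-mono : ∀ {P : Pred A p} {Q : Pred A q} (P? : Decidable P) (Q? : Decidable Q) →
  (∀ {x} → P x → Q x) → ∀ xs → count P? xs ≤ count Q? xs
count-mono P? Q? P⊆Q xs = Sublist.length-mono-≤ (Sublist.filter⁺ P? Q? (λ { refl → P⊆Q }) (⊆-refl {x = xs}))

count-none : ∀ {P : Pred A p} (P? : Decidable P) → (∀ x → ¬ P x) → ∀ xs → count P? xs ≡ 0
count-none P? ¬P xs = cong length (filter-none P? (All.universal ¬P xs))

count-split : ∀ {P : Pred A p} {Q : Pred A q} (P? : Decidable P) (Q? : Decidable Q) xs →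
  count P? xs ≡ count (P? ∩? Q?) xs + count (P? ∩? ∁? Q?) xs
count-split P? Q? [] = refl
count-split P? Q? (x ∷ xs) with P? x | Q? x
... | yes _ | yes _ = cong suc (count-split P? Q? xs)
... | yes _ | no _  = trans (cong suc (count-split P? Q? xs)) (sym (+-suc _ _))
... | no _  | _     = count-split P? Q? xs

count-map : ∀ {P : Pred B p} (P? : Decidable P) (f : A → B) xs → count P? (map f xs) ≡ count (P? ∘ f) xs
count-map P? f [] = refl
count-map P? f (x ∷ xs) with does (P? (f x))
... | true  = cong suc (count-map P? f xs)
... | false = count-map P? f xs

count-allSubsets-suc : ∀ {P : Pred (Subset (suc n)) p} (P? : Decidable P) →
  count P? (allSubsets (suc n)) ≡ count (P? ∘ (true ∷_)) (allSubsets n) + count (P? ∘ (false ∷_)) (allSubsets n)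
count-allSubsets-suc {n} P? = begin
  length (filter P? (map (true ∷_) S ++ map (false ∷_) S))          ≡⟨ cong length (filter-++ P? (map (true ∷_) S) _) ⟩
  length (filter P? (map (true ∷_) S) ++ filter P? (map (false ∷_) S)) ≡⟨ length-++ (filter P? (map (true ∷_) S)) ⟩
  count P? (map (true ∷_) S) + count P? (map (false ∷_) S)           ≡⟨ cong₂ _+_ (count-map P? (true ∷_) S) (count-map P? (false ∷_) S) ⟩
  count (P? ∘ (true ∷_)) S + count (P? ∘ (false ∷_)) S                ∎
  where
  open ≡-Reasoning
  S = allSubsets n

-- M ↦ M ─ T is injective on the supersets of T.
count-─≤count : ∀ (T : Subset n) {P : Pred (Subset n) p} (P? : Decidable P) →
  count (λ M → T ⊆? M ×-dec P? (M ─ T)) (allSubsets n) ≤ count P? (allSubsets n)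
count-─≤count [] P? = count-mono (λ M → [] ⊆? M ×-dec P? (M ─ [])) P? (λ { {[]} → proj₂ }) (allSubsets 0)
count-─≤count {suc n} (true ∷ T) P? = begin
  count D (allSubsets (suc n))                           ≡⟨ count-allSubsets-suc D ⟩
  count (D ∘ (true ∷_)) S + count (D ∘ (false ∷_)) S     ≡⟨ cong (count (D ∘ (true ∷_)) S +_) (count-none _ (λ M → inside⊈outside M ∘ proj₁) S) ⟩
  count (D ∘ (true ∷_)) S + 0                            ≡⟨ +-identityʳ _ ⟩
  count (D ∘ (true ∷_)) S                                ≤⟨ count-mono _ _ (map₁ drop-∷-⊆) S ⟩
  count (λ M → T ⊆? M ×-dec P? (false ∷ (M ─ T))) S      ≤⟨ count-─≤count T (P? ∘ (false ∷_)) ⟩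
  count (P? ∘ (false ∷_)) S                              ≤⟨ m≤n+m _ _ ⟩
  count (P? ∘ (true ∷_)) S + count (P? ∘ (false ∷_)) S   ≡⟨ count-allSubsets-suc P? ⟨
  count P? (allSubsets (suc n))                          ∎
  where
  open ≤-Reasoning
  S = allSubsets n
  D = λ M → (true ∷ T) ⊆? M ×-dec P? (M ─ (true ∷ T))
  inside⊈outside : ∀ M → ¬ (true ∷ T) ⊆ (false ∷ M)
  inside⊈outside M T⊆M with T⊆M here
  ... | ()
count-─≤count {suc n} (false ∷ T) P? = begin
  count D (allSubsets (suc n))                           ≡⟨ count-allSubsets-suc D ⟩
  count (D ∘ (true ∷_)) S + count (D ∘ (false ∷_)) S     ≤⟨ +-mono-≤ (count-mono _ _ (map₁ drop-∷-⊆) S) (count-mono _ _ (map₁ drop-∷-⊆) S) ⟩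
  count (λ M → T ⊆? M ×-dec P? (true ∷ (M ─ T))) S
    + count (λ M → T ⊆? M ×-dec P? (false ∷ (M ─ T))) S  ≤⟨ +-mono-≤ (count-─≤count T (P? ∘ (true ∷_))) (count-─≤count T (P? ∘ (false ∷_))) ⟩
  count (P? ∘ (true ∷_)) S + count (P? ∘ (false ∷_)) S   ≡⟨ count-allSubsets-suc P? ⟨
  count P? (allSubsets (suc n))                          ∎
  where
  open ≤-Reasoning
  S = allSubsets n
  D = λ M → (false ∷ T) ⊆? M ×-dec P? (M ─ (false ∷ T))

s≤s-Pplus+s-Pminus : ∀ {P : Program n} {r} → r ∈ₗ P → s P ≤ s (Pplus P r) + s (Pminus P r)
s≤s-Pplus+s-Pminus {n} {P} {r} r∈P = begin
  count (stable? P) Ms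
    ≡⟨ count-split (stable? P) r-applicable? Ms ⟩
  count (stable? P ∩? r-applicable?) Ms + count (stable? P ∩? ∁? r-applicable?) Ms
    ≤⟨ +-mono-≤ (count-mono _ (λ M → T ⊆? M ×-dec stable? (Pplus P r) (M ─ T))
                            (λ (M∈SM , app) → applicable⇒head∷pos⊆ r∈P M∈SM app , stable-Pplus r∈P M∈SM app) Ms)
                (count-mono _ (stable? (Pminus P r)) (λ (M∈SM , ¬app) → stable-Pminus r∈P M∈SM ¬app) Ms) ⟩
  count (λ M → T ⊆? M ×-dec stable? (Pplus P r) (M ─ T)) Ms + s (Pminus P r)
    ≤⟨ +-monoˡ-≤ (s (Pminus P r)) (count-─≤count T (stable? (Pplus P r))) ⟩
  s (Pplus P r) + s (Pminus P r) ∎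
  where
  open ≤-Reasoning
  Ms = allSubsets n
  T = fromList (head r ∷ pos r)
  r-applicable? = λ M → applicable? M r

corollary2 : ∀ {n} (P : Program n) (r : Clause n) → r ∈ₗ P →
    ((M : _) → Stable P M →
      ((All (_∈ M) (pos r) × All (_∉ M) (neg r)) →
         Stable (Pplus P r) (M ─ fromList (head r ∷ pos r)))
      × (¬ (All (_∈ M) (pos r) × All (_∉ M) (neg r)) →
         Stable (Pminus P r) M))
    × (s P ≤ s (Pplus P r) + s (Pminus P r))
corollary2 P r r∈P = (λ M M∈SM → stable-Pplus r∈P M∈SM , stable-Pminus r∈P M∈SM) , s≤s-Pplus+s-Pminus r∈P
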